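{- Let $V$ be an $\mathbb{F}_q$-subspace of $\mathbb{F}_{q^n}$ and let $s\geq 2$ be an integer. Then $H(V^{s-1})\subseteq H(V^s)$, and hence $h(V^{s-1})\leq h(V^s)$.
   Context: For $m\in\mathbb{N}$, $V^m=\langle v_1\cdots v_m: v_i\in V\rangle_{\mathbb{F}_q}$ (so $V^1=V$). For an $\mathbb{F}_q$-subspace $W$ of $\mathbb{F}_{q^n}$, $H(W)=\{x\in\mathbb{F}_{q^n}^*: xW=W\}\cup\{0\}$ and $h(W)=[H(W):\mathbb{F}_q]$. -}

module Defs where

open import Level using (0ℓ)
open import Data.Nat using (ℕ; zero; suc; _^_)
open import Data.Fin using (Fin; zero; suc)
open import Data.Unit using (⊤)
open import Data.Product using (Σ; _×_; ∃)
open import Data.Sum using (_⊎_)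
open import Relation.Nullary using (¬_)
open import Relation.Binary.PropositionalEquality using (_≡_)
open import Algebra.Bundles using (CommutativeRing)

record IsFieldRing (R : CommutativeRing 0ℓ 0ℓ) : Set where
  open CommutativeRing R hiding (zero)
  field
    1≉0 : ¬ (1# ≈ 0#)
    inverse : ∀ x → ¬ (x ≈ 0#) → Σ Carrier λ y → x * y ≈ 1#

module _ (L : CommutativeRing 0ℓ 0ℓ) where
  open CommutativeRing L hiding (zero)

  HasSize : (Carrier → Set) → ℕ → Set
  HasSize P N =
    Σ (Fin N → Carrier) λ f →
      (∀ i → P (f i)) ×
      (∀ i j → f i ≈ f j → i ≡ j) ×
      (∀ x → P x → ∃ λ i → f i ≈ x)

  Respects≈ : (Carrier → Set) → Set
  Respects≈ P = ∀ {x y} → x ≈ y → P x → P y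

  record IsSubfield (K : Carrier → Set) : Set where
    field
      resp : Respects≈ K
      K0 : K 0#
      K1 : K 1#
      K+ : ∀ {x y} → K x → K y → K (x + y)
      K- : ∀ {x} → K x → K (- x)
      K* : ∀ {x y} → K x → K y → K (x * y)
      Kinv : ∀ {x y} → K x → x * y ≈ 1# → K y

  record FFExt (q n : ℕ) (K : Carrier → Set) : Set where
    field
      isField : IsFieldRing L
      isSubfield : IsSubfield K
      sizeL : HasSize (λ _ → ⊤) (q ^ n)
      sizeK : HasSize K q

  module _ (K : Carrier → Set) where

    record IsSubspace (W : Carrier → Set) : Set where
      field
        resp : Respects≈ W
        W0 : W 0#
        W+ : ∀ {x y} → W x → W y → W (x + y)
        Wscal : ∀ {a x} → K a → W x → W (a * x)

    data Span (S : Carrier → Set) : Carrier → Set where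
      gen  : ∀ {x} → S x → Span S x
      zer  : Span S 0#
      add  : ∀ {x y} → Span S x → Span S y → Span S (x + y)
      scal : ∀ {a x} → K a → Span S x → Span S (a * x)
      resp : ∀ {x y} → x ≈ y → Span S x → Span S y

    Prods : (Carrier → Set) → ℕ → Carrier → Set
    Prods V zero x = x ≈ 1#
    Prods V (suc m) x = Σ Carrier λ a → Σ Carrier λ b → Prods V m a × V b × x ≈ a * b

    Pow : (Carrier → Set) → ℕ → Carrier → Set
    Pow V m = Span (Prods V m)

    H : (Carrier → Set) → Carrier → Set
    H W x = x ≈ 0# ⊎
      (¬ (x ≈ 0#) ×
       (∀ w → W w → W (x * w)) ×
       (∀ w → W w → Σ Carrier λ u → W u × w ≈ x * u))

    lincomb : ∀ {k} → (Fin k → Carrier) → (Fin k → Carrier) → Carrier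
    lincomb {zero} c b = 0#
    lincomb {suc k} c b = c zero * b zero + lincomb (λ i → c (suc i)) (λ i → b (suc i))

    IsDim : (Carrier → Set) → ℕ → Set
    IsDim P k =
      Σ (Fin k → Carrier) λ b →
        (∀ i → P (b i)) ×
        (∀ c → (∀ i → K (c i)) → lincomb c b ≈ 0# → ∀ i → c i ≈ 0#) ×
        (∀ x → P x → Σ (Fin k → Carrier) λ c → (∀ i → K (c i)) × x ≈ lincomb c b)

{-# OPTIONS --safe #-}
-- If x ≠ 0 satisfies x V^(s-1) = V^(s-1), then multiplying by V gives
-- x V^s = x V^(s-1) V = V^(s-1) V = V^s, so H(V^(s-1)) ⊆ H(V^s).  An inclusion of
-- 𝔽_q-subspaces of 𝔽_{q^n} cannot decrease dimension: expressing a basis of the smaller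
-- space in a basis of the larger one turns coordinate vectors 𝔽_q^h₁ injectively into
-- coordinate vectors 𝔽_q^h₂, so q^h₁ ≤ q^h₂, and h₁ ≤ h₂ since q > 1.
module Submission where

open import Defs
open import Level using (0ℓ)
open import Algebra.Bundles using (CommutativeRing)
open import Data.Nat using (ℕ; zero; suc; _≤_; _<_; _∸_; _^_; s≤s; z≤n; _≤?_)
open import Data.Nat.Properties using (≰⇒>; ^-monoʳ-<; ≤⇒≯)
open import Data.Fin using (Fin; finToFun; funToFin; combine)
import Data.Fin as Fin
open import Data.Fin.Properties using (injective⇒≤; finToFun-funToFin; funToFin-finToFin)
open import Data.Product using (Σ; _×_; _,_; proj₁; proj₂)
open import Data.Sum using (inj₁; inj₂)
open import Data.Empty using (⊥-elim)
open import Relation.Nullary using (yes; no; ¬_)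
open import Relation.Binary.PropositionalEquality as ≡ using (_≡_; _≗_)

^-cancelʳ-≤ : ∀ q {a b} → 1 < q → q ^ a ≤ q ^ b → a ≤ b
^-cancelʳ-≤ q {a} {b} 1<q qᵃ≤qᵇ with a ≤? b
... | yes a≤b = a≤b
... | no  a≰b = ⊥-elim (≤⇒≯ qᵃ≤qᵇ (^-monoʳ-< q 1<q (≰⇒> a≰b)))

funToFin-cong : ∀ {m n} {f g : Fin m → Fin n} → f ≗ g → funToFin f ≡ funToFin g
funToFin-cong {zero}  f≗g = ≡.refl
funToFin-cong {suc m} f≗g = ≡.cong₂ combine (f≗g Fin.zero) (funToFin-cong (λ i → f≗g (Fin.suc i)))
  where import Data.Fin as Fin

injective-on-functions⇒≤ : ∀ {q a b} → 1 < q → (G : (Fin a → Fin q) → (Fin b → Fin q)) →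
                           (∀ d d′ → G d ≗ G d′ → d ≗ d′) → a ≤ b
injective-on-functions⇒≤ {q} {a} {b} 1<q G G-injective =
  ^-cancelʳ-≤ q 1<q (injective⇒≤ {f = G′} G′-injective)
  where
    G′ : Fin (q ^ a) → Fin (q ^ b)
    G′ k = funToFin (G (finToFun k))

    G′-injective : ∀ {k k′} → G′ k ≡ G′ k′ → k ≡ k′
    G′-injective {k} {k′} eq = begin
      k                               ≡⟨ funToFin-finToFin {a} {q} k ⟨
      funToFin (finToFun {q} {a} k)   ≡⟨ funToFin-cong (G-injective _ _ G-agrees) ⟩
      funToFin (finToFun {q} {a} k′)  ≡⟨ funToFin-finToFin {a} {q} k′ ⟩
      k′                              ∎
      where
        open ≡.≡-Reasoning
        G-agrees : G (finToFun k) ≗ G (finToFun k′)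
        G-agrees j = begin
          G (finToFun k) j                     ≡⟨ finToFun-funToFin (G (finToFun k)) j ⟨
          finToFun (G′ k) j                    ≡⟨ ≡.cong (λ z → finToFun z j) eq ⟩
          finToFun (G′ k′) j                   ≡⟨ finToFun-funToFin (G (finToFun k′)) j ⟩
          G (finToFun k′) j                    ∎

module _ (L : CommutativeRing 0ℓ 0ℓ) where
  open CommutativeRing L hiding (zero)
  open import Algebra.Properties.Ring ring using (-‿distribˡ-*; -‿+-comm; -0#≈0#; x∙y⁻¹≈ε⇒x≈y)
  open import Algebra.Properties.CommutativeSemigroup +-commutativeSemigroup using (interchange)
  open import Algebra.Properties.CommutativeSemigroup *-commutativeSemigroup using (x∙yz≈y∙xz)
  open import Relation.Binary.Reasoning.Setoid setoid

  HasSize⇒1< : ∀ {P q x y} → HasSize L P q → P x → P y → ¬ x ≈ y → 1 < q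
  HasSize⇒1< {q = zero} (_ , _ , _ , onto) Px _ _ with onto _ Px
  ... | () , _
  HasSize⇒1< {q = suc zero} (_ , _ , _ , onto) Px Py x≉y with onto _ Px | onto _ Py
  ... | Fin.zero , fx | Fin.zero , fy = ⊥-elim (x≉y (trans (sym fx) fy))
  HasSize⇒1< {q = suc (suc q)} _ _ _ _ = s≤s (s≤s z≤n)

  module _ (K : Carrier → Set) where

    lc : ∀ {k} → (Fin k → Carrier) → (Fin k → Carrier) → Carrier
    lc = lincomb L K

    lincomb-cong : ∀ {k} {c c′ b b′ : Fin k → Carrier} →
                   (∀ i → c i ≈ c′ i) → (∀ i → b i ≈ b′ i) → lc c b ≈ lc c′ b′
    lincomb-cong {zero}  c≈c′ b≈b′ = refl
    lincomb-cong {suc k} c≈c′ b≈b′ =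
      +-cong (*-cong (c≈c′ Fin.zero) (b≈b′ Fin.zero))
             (lincomb-cong (λ i → c≈c′ (Fin.suc i)) (λ i → b≈b′ (Fin.suc i)))

    lincomb-zeroˡ : ∀ {k} (b : Fin k → Carrier) → lc (λ _ → 0#) b ≈ 0#
    lincomb-zeroˡ {zero}  b = refl
    lincomb-zeroˡ {suc k} b = trans (+-cong (zeroˡ _) (lincomb-zeroˡ (λ i → b (Fin.suc i)))) (+-identityˡ 0#)

    lincomb-+ : ∀ {k} (c c′ b : Fin k → Carrier) → lc c b + lc c′ b ≈ lc (λ i → c i + c′ i) b
    lincomb-+ {zero}  c c′ b = +-identityˡ 0#
    lincomb-+ {suc k} c c′ b = begin
      (c₀ * b₀ + lc cₛ bₛ) + (c′₀ * b₀ + lc c′ₛ bₛ)  ≈⟨ interchange _ _ _ _ ⟩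
      (c₀ * b₀ + c′₀ * b₀) + (lc cₛ bₛ + lc c′ₛ bₛ)  ≈⟨ +-cong (sym (distribʳ b₀ c₀ c′₀)) (lincomb-+ cₛ c′ₛ bₛ) ⟩
      (c₀ + c′₀) * b₀ + lc (λ i → cₛ i + c′ₛ i) bₛ   ∎
      where
        c₀ c′₀ b₀ : Carrier
        c₀ = c Fin.zero; c′₀ = c′ Fin.zero; b₀ = b Fin.zero
        cₛ c′ₛ bₛ : Fin k → Carrier
        cₛ i = c (Fin.suc i); c′ₛ i = c′ (Fin.suc i); bₛ i = b (Fin.suc i)

    lincomb-*ˡ : ∀ {k} a (c b : Fin k → Carrier) → a * lc c b ≈ lc (λ i → a * c i) b
    lincomb-*ˡ {zero}  a c b = zeroʳ a
    lincomb-*ˡ {suc k} a c b =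
      trans (distribˡ a _ _)
            (+-cong (sym (*-assoc a _ _)) (lincomb-*ˡ a (λ i → c (Fin.suc i)) (λ i → b (Fin.suc i))))

    lincomb-neg : ∀ {k} (c b : Fin k → Carrier) → - lc c b ≈ lc (λ i → - c i) b
    lincomb-neg {zero}  c b = -0#≈0#
    lincomb-neg {suc k} c b =
      trans (sym (-‿+-comm _ _))
            (+-cong (-‿distribˡ-* _ _) (lincomb-neg (λ i → c (Fin.suc i)) (λ i → b (Fin.suc i))))

    lincomb-exchange : ∀ {a k} (d : Fin a → Carrier) (C : Fin a → Fin k → Carrier) (b : Fin k → Carrier) →
                       lc d (λ i → lc (C i) b) ≈ lc (λ j → lc d (λ i → C i j)) b
    lincomb-exchange {zero}  d C b = sym (lincomb-zeroˡ b)
    lincomb-exchange {suc a} d C b =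
      trans (+-cong (lincomb-*ˡ (d Fin.zero) (C Fin.zero) b)
                    (lincomb-exchange (λ i → d (Fin.suc i)) (λ i → C (Fin.suc i)) b))
            (lincomb-+ _ _ b)

    LinearlyIndependent : ∀ {k} → (Fin k → Carrier) → Set
    LinearlyIndependent b = ∀ c → (∀ i → K (c i)) → lc c b ≈ 0# → ∀ i → c i ≈ 0#

    module _ (K-subfield : IsSubfield L K) where
      open IsSubfield K-subfield using (K0; K+; K-; K*)

      lincomb-closed : ∀ {k} {c b : Fin k → Carrier} → (∀ i → K (c i)) → (∀ i → K (b i)) → K (lc c b)
      lincomb-closed {zero}  Kc Kb = K0
      lincomb-closed {suc k} Kc Kb =
        K+ (K* (Kc Fin.zero) (Kb Fin.zero)) (lincomb-closed (λ i → Kc (Fin.suc i)) (λ i → Kb (Fin.suc i)))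

      independent⇒coefficients-unique : ∀ {k} {b c c′ : Fin k → Carrier} → LinearlyIndependent b →
                                        (∀ i → K (c i)) → (∀ i → K (c′ i)) →
                                        lc c b ≈ lc c′ b → ∀ i → c i ≈ c′ i
      independent⇒coefficients-unique {b = b} {c} {c′} indep Kc Kc′ same i =
        x∙y⁻¹≈ε⇒x≈y _ _ (indep (λ i → c i - c′ i) (λ i → K+ (Kc i) (K- (Kc′ i))) difference-vanishes i)
        where
          difference-vanishes : lc (λ i → c i - c′ i) b ≈ 0#
          difference-vanishes = begin
            lc (λ i → c i - c′ i) b             ≈⟨ lincomb-+ c (λ i → - c′ i) b ⟨
            lc c b + lc (λ i → - c′ i) b        ≈⟨ +-cong same (sym (lincomb-neg c′ b)) ⟩
            lc c′ b - lc c′ b                   ≈⟨ -‿inverseʳ _ ⟩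
            0#                                  ∎

      independent-in-span⇒≤ : ∀ {q a b} → HasSize L K q → 1 < q →
                              (e : Fin a → Carrier) → LinearlyIndependent e →
                              (f : Fin b → Carrier) (C : Fin a → Fin b → Carrier) →
                              (∀ i j → K (C i j)) → (∀ i → e i ≈ lc (C i) f) → a ≤ b
      independent-in-span⇒≤ (elem , Kelem , elem-injective , onto) 1<q e e-indep f C KC e≈Cf =
        injective-on-functions⇒≤ 1<q G G-injective
        where
          coords : (Fin _ → Fin _) → Fin _ → Carrier
          coords d j = lc (λ i → elem (d i)) (λ i → C i j)

          K-coords : ∀ d j → K (coords d j)
          K-coords d j = lincomb-closed (λ i → Kelem (d i)) (λ i → KC i j)

          G : (Fin _ → Fin _) → Fin _ → Fin _
          G d j = proj₁ (onto (coords d j) (K-coords d j))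

          coords-via-f : ∀ d → lc (λ i → elem (d i)) e ≈ lc (coords d) f
          coords-via-f d = trans (lincomb-cong (λ _ → refl) e≈Cf) (lincomb-exchange (λ i → elem (d i)) C f)

          G-injective : ∀ d d′ → G d ≗ G d′ → d ≗ d′
          G-injective d d′ Gd≗Gd′ = λ i → elem-injective _ _ (same-coefficients i)
            where
              same-coords : ∀ j → coords d j ≈ coords d′ j
              same-coords j = begin
                coords d j         ≈⟨ proj₂ (onto (coords d j) (K-coords d j)) ⟨
                elem (G d j)       ≡⟨ ≡.cong elem (Gd≗Gd′ j) ⟩
                elem (G d′ j)      ≈⟨ proj₂ (onto (coords d′ j) (K-coords d′ j)) ⟩
                coords d′ j        ∎

              same-coefficients : ∀ i → elem (d i) ≈ elem (d′ i)
              same-coefficients = independent⇒coefficients-unique e-indep (λ i → Kelem (d i)) (λ i → Kelem (d′ i))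
                (trans (coords-via-f d) (trans (lincomb-cong same-coords (λ _ → refl)) (sym (coords-via-f d′))))

      IsDim-mono : ∀ {q A B a b} → HasSize L K q → 1 < q →
                   (∀ x → A x → B x) → IsDim L K A a → IsDim L K B b → a ≤ b
      IsDim-mono size 1<q A⊆B (e , Ae , e-indep , _) (f , _ , _ , f-spans) =
        independent-in-span⇒≤ size 1<q e e-indep f
          (λ i → proj₁ (in-span i)) (λ i → proj₁ (proj₂ (in-span i))) (λ i → proj₂ (proj₂ (in-span i)))
        where
          in-span : ∀ i → Σ (Fin _ → Carrier) λ c → (∀ j → K (c j)) × e i ≈ lc c f
          in-span i = f-spans (e i) (A⊆B (e i) (Ae i))

    module _ (V : Carrier → Set) where

      Pow-*-V : ∀ {m a b} → Pow L K V m a → V b → Pow L K V (suc m) (a * b)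
      Pow-*-V         (gen p)       Vb = gen (_ , _ , p , Vb , refl)
      Pow-*-V         zer           Vb = resp (sym (zeroˡ _)) zer
      Pow-*-V {m}     (add p p′)    Vb = resp (sym (distribʳ _ _ _)) (add (Pow-*-V {m} p Vb) (Pow-*-V {m} p′ Vb))
      Pow-*-V {m}     (scal Kc p)   Vb = resp (sym (*-assoc _ _ _)) (scal Kc (Pow-*-V {m} p Vb))
      Pow-*-V {m}     (resp a≈a′ p) Vb = resp (*-congʳ a≈a′) (Pow-*-V {m} p Vb)

      module _ (x : Carrier) {m : ℕ} where

        *-stable-Pow-suc : (∀ a → Pow L K V m a → Pow L K V m (x * a)) →
                           ∀ {w} → Pow L K V (suc m) w → Pow L K V (suc m) (x * w)
        *-stable-Pow-suc stable (gen (a , b , pa , Vb , w≈ab)) =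
          resp (trans (*-assoc x a b) (*-congˡ (sym w≈ab))) (Pow-*-V {m} (stable a (gen pa)) Vb)
        *-stable-Pow-suc stable zer          = resp (sym (zeroʳ x)) zer
        *-stable-Pow-suc stable (add p p′)   =
          resp (sym (distribˡ x _ _)) (add (*-stable-Pow-suc stable p) (*-stable-Pow-suc stable p′))
        *-stable-Pow-suc stable (scal Kc p)  = resp (x∙yz≈y∙xz _ x _) (scal Kc (*-stable-Pow-suc stable p))
        *-stable-Pow-suc stable (resp w≈w′ p) = resp (*-congˡ w≈w′) (*-stable-Pow-suc stable p)

        *-divides-Pow-suc : (∀ a → Pow L K V m a → Σ Carrier λ u → Pow L K V m u × a ≈ x * u) →
                            ∀ {w} → Pow L K V (suc m) w → Σ Carrier λ u → Pow L K V (suc m) u × w ≈ x * u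
        *-divides-Pow-suc divides (gen (a , b , pa , Vb , w≈ab)) with divides a (gen pa)
        ... | u , pu , a≈xu = u * b , Pow-*-V {m} pu Vb , trans w≈ab (trans (*-congʳ a≈xu) (*-assoc x u b))
        *-divides-Pow-suc divides zer = 0# , zer , sym (zeroʳ x)
        *-divides-Pow-suc divides (add p p′) with *-divides-Pow-suc divides p | *-divides-Pow-suc divides p′
        ... | u , pu , w≈xu | u′ , pu′ , w′≈xu′ =
          u + u′ , add pu pu′ , trans (+-cong w≈xu w′≈xu′) (sym (distribˡ x u u′))
        *-divides-Pow-suc divides (scal {c} Kc p) with *-divides-Pow-suc divides p
        ... | u , pu , w≈xu = c * u , scal Kc pu , trans (*-congˡ w≈xu) (x∙yz≈y∙xz c x u)
        *-divides-Pow-suc divides (resp w≈w′ p) with *-divides-Pow-suc divides p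
        ... | u , pu , w≈xu = u , pu , trans (sym w≈w′) w≈xu

      H-Pow-suc : ∀ m x → H L K (Pow L K V m) x → H L K (Pow L K V (suc m)) x
      H-Pow-suc m x (inj₁ x≈0) = inj₁ x≈0
      H-Pow-suc m x (inj₂ (x≉0 , stable , divides)) =
        inj₂ (x≉0 , (λ _ → *-stable-Pow-suc x {m} stable) , (λ _ → *-divides-Pow-suc x {m} divides))

mainTheorem12 : (q n : ℕ) (L : CommutativeRing 0ℓ 0ℓ) (K : CommutativeRing.Carrier L → Set) →
    FFExt L q n K →
    (V : CommutativeRing.Carrier L → Set) → IsSubspace L K V →
    (s : ℕ) → 2 ≤ s →
    (∀ x → H L K (Pow L K V (s ∸ 1)) x → H L K (Pow L K V s) x) ×
    (∀ h₁ h₂ → IsDim L K (H L K (Pow L K V (s ∸ 1))) h₁ → IsDim L K (H L K (Pow L K V s)) h₂ → h₁ ≤ h₂)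
mainTheorem12 q n L K ff V _ (suc (suc m)) (s≤s (s≤s z≤n)) =
  H-inclusion , λ _ _ → IsDim-mono L K isSubfield sizeK 1<q H-inclusion
  where
    open FFExt ff
    open IsSubfield isSubfield using (K0; K1)
    open IsFieldRing isField using (1≉0)

    H-inclusion : ∀ x → H L K (Pow L K V (suc m)) x → H L K (Pow L K V (suc (suc m))) x
    H-inclusion = H-Pow-suc L K V (suc m)

    1<q : 1 < q
    1<q = HasSize⇒1< L sizeK K1 K0 1≉0
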